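{- Let $\mathcal{M}=\mathbb{Q}^{<\omega}$ and let $R(\bar x,\bar y)$ be a relation definable in $\langle\mathcal{M},+\rangle$. Then there is a natural number $K$ such that for every tuple $\bar x$ of elements of $\mathcal{M}$: $\lnot(\exists_{>K}\bar y)R(\bar x,\bar y)\ \lor\ \lnot(\exists_{>K}\bar y)\lnot R(\bar x,\bar y)$.
   Context: $\mathcal{M}=\mathbb{Q}^{<\omega}$ is the $\mathbb{Q}$-vector space of finitely supported rational sequences. "Definable" means first-order definable without parameters. $(\exists_{>k}y)Q(y)$ means there are at least $k+1$ pairwise distinct $y$ with $Q(y)$; for tuples it is defined inductively by $(\exists_{>k}y_1,\dots,y_m)Q(y_1,\dots,y_m)\equiv(\exists_{>k}y_1)(\exists_{>k}y_2,\dots,y_m)Q(y_1,\dots,y_m)$. -}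

module Defs where

open import Data.Nat using (ℕ; zero; suc; _+_)
open import Data.Fin using (Fin)
open import Data.Rational using (ℚ; 0ℚ) renaming (_+_ to _+ℚ_)
open import Data.List using (List; []; _∷_)
open import Data.Vec using (Vec; []; _∷_; lookup)
open import Data.Product using (Σ; _×_)
open import Data.Empty using (⊥)
open import Relation.Binary.PropositionalEquality using (_≡_; _≢_)
open import Relation.Nullary using (¬_)

-- An element is represented by a finite list of rationals (its initial
-- segment); the sequence is the list padded with zeros.  Equality in M
-- is equality of the represented sequences (pointwise).

M : Set
M = List ℚ

coord : M → ℕ → ℚ
coord []       _       = 0ℚ
coord (q ∷ _)  zero    = q
coord (_ ∷ l)  (suc n) = coord l n

_≈M_ : M → M → Set
a ≈M b = ∀ n → coord a n ≡ coord b n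

_+M_ : M → M → M
[]      +M b       = b
(p ∷ a) +M []      = p ∷ a
(p ∷ a) +M (q ∷ b) = (p +ℚ q) ∷ (a +M b)

data Term (n : ℕ) : Set where
  var  : Fin n → Term n
  _⊕_  : Term n → Term n → Term n

data Formula : ℕ → Set where
  _≐_  : ∀ {n} → Term n → Term n → Formula n
  ¬'_  : ∀ {n} → Formula n → Formula n
  _∧'_ : ∀ {n} → Formula n → Formula n → Formula n
  ∃'_  : ∀ {n} → Formula (suc n) → Formula n

evalT : ∀ {n} → Term n → Vec M n → M
evalT (var i) ρ = lookup ρ i
evalT (s ⊕ t) ρ = evalT s ρ +M evalT t ρ

-- Tarski satisfaction in ⟨M,+⟩; variable 0 is the innermost bound one.
Sat : ∀ {n} → Formula n → Vec M n → Set
Sat (s ≐ t)   ρ = evalT s ρ ≈M evalT t ρ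
Sat (¬' φ)    ρ = ¬ Sat φ ρ
Sat (φ ∧' ψ)  ρ = Sat φ ρ × Sat ψ ρ
Sat (∃' φ)    ρ = Σ M (λ a → Sat φ (a ∷ ρ))

∃>1 : ℕ → (M → Set) → Set
∃>1 k Q = Σ (Fin (suc k) → M) λ ys →
            (∀ i j → i ≢ j → ¬ (ys i ≈M ys j)) × (∀ i → Q (ys i))

-- For tuples, inductively:
-- (∃_{>k} y₁,…,y_m) Q ≡ (∃_{>k} y₁)(∃_{>k} y₂,…,y_m) Q.
-- (Length 0 is only an auxiliary base case: it means Q [].)
∃> : ℕ → (m : ℕ) → (Vec M m → Set) → Set
∃> k zero    Q = Q []
∃> k (suc m) Q = ∃>1 k (λ y → ∃> k m (λ ys → Q (y ∷ ys)))

-- ⟨M,+⟩ is an infinite-dimensional ℚ-vector space, and it eliminates quantifiers down to boolean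
-- combinations of linear equations L = 0 with rational coefficients.  For q quantifier-free in
-- y and parameters, each atom involving y has a unique solution for y (its test point), and every
-- other y satisfies exactly the atoms that a "point at infinity" (a unit vector beyond the support
-- of all parameters) satisfies, namely those not involving y.  Hence ∃y q is equivalent to q at
-- infinity or at one of the test points, and, uniformly in the parameters, either q or ¬q has at
-- most as many solutions as q has atoms.  For tuples (y , ys) induct on their length: by
-- elimination, "∃_{>K₁} ys q(y, ys)" is again quantifier-free in y, so the one-variable bound K₂
-- for it together with the inductive bound K₁ for the fibres gives the bound K₁ ⊔ K₂.
module Submission where

open import Defs
open import Data.Nat using (ℕ; suc; _+_)
open import Data.Vec using (Vec; _++_)
open import Data.Product using (∃-syntax)
open import Data.Sum using (_⊎_)
open import Relation.Nullary using (¬_)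

open import Data.Nat using (zero; _≤_; _<_; _<?_; _⊔_; s≤s)
open import Data.Nat.Properties using (≤-trans; ≮⇒≥; m≤m⊔n; m≤n⊔m; n<1+n; allUpTo?)
open import Data.Rational using (ℚ; 0ℚ; 1ℚ; 1/_; ≢-nonZero)
  renaming (_+_ to _+ℚ_; _*_ to _*ℚ_; -_ to -ℚ_)
open import Data.Rational.Properties using (+-comm; *-inverseˡ) renaming (_≟_ to _≟ℚ_)
open import Data.Rational.Solver using (module +-*-Solver)
import Data.List as List
open import Data.List using (List; []; _∷_; length) renaming (_++_ to _++ˡ_; map to mapˡ)
open import Data.List.Relation.Unary.All as All using (All; []; _∷_)
open import Data.List.Relation.Unary.All.Properties using (++⁻; ¬Any⇒All¬)
open import Data.List.Relation.Unary.Any as Any using (Any; here; there; any?)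
open import Data.List.Relation.Unary.Any.Properties using (lookup-index)
open import Data.Fin using (Fin; zero; suc; splitAt; inject≤)
open import Data.Fin.Properties using (pigeonhole; <⇒≢; inject≤-injective) renaming (_≟_ to _≟ᶠ_)
open import Data.Vec using ([]; _∷_; lookup)
open import Data.Vec.Properties using (lookup-splitAt)
open import Data.Vec.Functional using () renaming (_∷_ to _∷ᶠ_)
open import Data.Product using (Σ; _×_; _,_; proj₁; proj₂)
open import Data.Sum using (inj₁; inj₂; [_,_]′)
open import Data.Maybe using (Maybe; just; nothing)
open import Function using (_∘_; id)
open import Function.Bundles using (_⇔_; mk⇔; Equivalence)
import Function.Properties.Equivalence as ⇔
open import Function.Related.TypeIsomorphisms using (¬-cong-⇔)
open import Data.Product.Function.NonDependent.Propositional using (_×-⇔_)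
open import Data.Sum.Function.Propositional using (_⊎-⇔_)
open import Relation.Nullary using (Dec; yes; no; contradiction)
open import Relation.Nullary.Decidable using (map′; _×-dec_; _⊎-dec_; ¬?)
open import Relation.Binary.PropositionalEquality
  using (_≡_; _≢_; refl; sym; trans; cong; cong₂; subst; module ≡-Reasoning)

open Equivalence using (to; from)
open +-*-Solver using (solve; _:=_; _:+_; _:*_; :-_; con)

private
  variable
    V W : Set
    K m : ℕ

∀-cong-⇔ : {I : Set} {A B : I → Set} → (∀ i → A i ⇔ B i) → (∀ i → A i) ⇔ (∀ i → B i)
∀-cong-⇔ A⇔B = mk⇔ (λ a i → to (A⇔B i) (a i)) (λ b i → from (A⇔B i) (b i))

∃-cong-⇔ : {I : Set} {A B : I → Set} → (∀ i → A i ⇔ B i) → Σ I A ⇔ Σ I B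
∃-cong-⇔ A⇔B = mk⇔ (λ (i , a) → i , to (A⇔B i) a) (λ (i , b) → i , from (A⇔B i) b)

scaleM : ℚ → M → M
scaleM c = mapˡ (c *ℚ_)

coord-+M : ∀ a b k → coord (a +M b) k ≡ coord a k +ℚ coord b k
coord-+M []      b       k       = solve 1 (λ x → x := con 0ℚ :+ x) refl (coord b k)
coord-+M (p ∷ a) []      k       = solve 1 (λ x → x := x :+ con 0ℚ) refl (coord (p ∷ a) k)
coord-+M (p ∷ a) (q ∷ b) zero    = refl
coord-+M (p ∷ a) (q ∷ b) (suc k) = coord-+M a b k

coord-scaleM : ∀ c a k → coord (scaleM c a) k ≡ c *ℚ coord a k
coord-scaleM c []      k       = solve 1 (λ c → con 0ℚ := c :* con 0ℚ) refl c
coord-scaleM c (p ∷ a) zero    = refl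
coord-scaleM c (p ∷ a) (suc k) = coord-scaleM c a k

coord-beyond : ∀ a {k} → length a ≤ k → coord a k ≡ 0ℚ
coord-beyond []      _       = refl
coord-beyond (p ∷ a) (s≤s h) = coord-beyond a h

unit : ℕ → M
unit zero    = 1ℚ ∷ []
unit (suc n) = 0ℚ ∷ unit n

coord-unit : ∀ n → coord (unit n) n ≡ 1ℚ
coord-unit zero    = refl
coord-unit (suc n) = coord-unit n

∀?-eventually : {P : ℕ → Set} → (∀ k → Dec (P k)) →
                ∀ B → (∀ {k} → B ≤ k → P k) → Dec (∀ k → P k)
∀?-eventually {P} P? B beyond = map′ everywhere (λ all k<B → all _) (allUpTo? P? B)
  where
  everywhere : (∀ {k} → k < B → P k) → ∀ k → P k
  everywhere below k with k <? B
  ... | yes k<B = below k<B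
  ... | no  k≮B = beyond (≮⇒≥ k≮B)

_≈M?_ : (a b : M) → Dec (a ≈M b)
a ≈M? b = ∀?-eventually (λ k → coord a k ≟ℚ coord b k) (length a ⊔ length b) λ h →
  trans (coord-beyond a (≤-trans (m≤m⊔n _ _) h)) (sym (coord-beyond b (≤-trans (m≤n⊔m _ _) h)))

LinForm : Set → Set
LinForm V = List (V × ℚ)

⟦_⟧ : LinForm V → (V → M) → M
⟦ []          ⟧ ρ = []
⟦ (v , c) ∷ L ⟧ ρ = scaleM c (ρ v) +M ⟦ L ⟧ ρ

varForm : V → LinForm V
varForm v = (v , 1ℚ) ∷ []

scale : ℚ → LinForm V → LinForm V
scale d = mapˡ (λ (v , c) → v , d *ℚ c)

_⊖_ : LinForm V → LinForm V → LinForm V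
L ⊖ L′ = L ++ˡ scale (-ℚ 1ℚ) L′

renameForm : (V → W) → LinForm V → LinForm W
renameForm f = mapˡ (λ (v , c) → f v , c)

coord-⟦∷⟧ : ∀ v c (L : LinForm V) ρ k →
            coord (⟦ (v , c) ∷ L ⟧ ρ) k ≡ c *ℚ coord (ρ v) k +ℚ coord (⟦ L ⟧ ρ) k
coord-⟦∷⟧ v c L ρ k = trans (coord-+M (scaleM c (ρ v)) (⟦ L ⟧ ρ) k)
                            (cong (_+ℚ coord (⟦ L ⟧ ρ) k) (coord-scaleM c (ρ v) k))

⟦varForm⟧ : ∀ (v : V) ρ → ⟦ varForm v ⟧ ρ ≈M ρ v
⟦varForm⟧ v ρ k = trans (coord-⟦∷⟧ v 1ℚ [] ρ k)
                        (solve 1 (λ x → con 1ℚ :* x :+ con 0ℚ := x) refl (coord (ρ v) k))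

coord-⟦++⟧ : ∀ (L L′ : LinForm V) ρ k →
             coord (⟦ L ++ˡ L′ ⟧ ρ) k ≡ coord (⟦ L ⟧ ρ) k +ℚ coord (⟦ L′ ⟧ ρ) k
coord-⟦++⟧ []            L′ ρ k = solve 1 (λ r → r := con 0ℚ :+ r) refl (coord (⟦ L′ ⟧ ρ) k)
coord-⟦++⟧ ((v , c) ∷ L) L′ ρ k = begin
  coord (⟦ (v , c) ∷ L ++ˡ L′ ⟧ ρ) k  ≡⟨ coord-⟦∷⟧ v c (L ++ˡ L′) ρ k ⟩
  c *ℚ x +ℚ coord (⟦ L ++ˡ L′ ⟧ ρ) k  ≡⟨ cong (c *ℚ x +ℚ_) (coord-⟦++⟧ L L′ ρ k) ⟩
  c *ℚ x +ℚ (l +ℚ r)                  ≡⟨ solve 4 (λ c x l r → c :* x :+ (l :+ r) := (c :* x :+ l) :+ r)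
                                               refl c x l r ⟩
  (c *ℚ x +ℚ l) +ℚ r                  ≡⟨ cong (_+ℚ r) (sym (coord-⟦∷⟧ v c L ρ k)) ⟩
  coord (⟦ (v , c) ∷ L ⟧ ρ) k +ℚ r    ∎
  where
  open ≡-Reasoning
  x = coord (ρ v) k
  l = coord (⟦ L ⟧ ρ) k
  r = coord (⟦ L′ ⟧ ρ) k

coord-⟦scale⟧ : ∀ d (L : LinForm V) ρ k → coord (⟦ scale d L ⟧ ρ) k ≡ d *ℚ coord (⟦ L ⟧ ρ) k
coord-⟦scale⟧ d []            ρ k = solve 1 (λ d → con 0ℚ := d :* con 0ℚ) refl d
coord-⟦scale⟧ d ((v , c) ∷ L) ρ k = begin
  coord (⟦ scale d ((v , c) ∷ L) ⟧ ρ) k     ≡⟨ coord-⟦∷⟧ v (d *ℚ c) (scale d L) ρ k ⟩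
  d *ℚ c *ℚ x +ℚ coord (⟦ scale d L ⟧ ρ) k  ≡⟨ cong (d *ℚ c *ℚ x +ℚ_) (coord-⟦scale⟧ d L ρ k) ⟩
  d *ℚ c *ℚ x +ℚ d *ℚ l                     ≡⟨ solve 4 (λ d c x l → d :* c :* x :+ d :* l := d :* (c :* x :+ l))
                                                     refl d c x l ⟩
  d *ℚ (c *ℚ x +ℚ l)                        ≡⟨ cong (d *ℚ_) (sym (coord-⟦∷⟧ v c L ρ k)) ⟩
  d *ℚ coord (⟦ (v , c) ∷ L ⟧ ρ) k          ∎
  where
  open ≡-Reasoning
  x = coord (ρ v) k
  l = coord (⟦ L ⟧ ρ) k

⟦⟧-cong : ∀ (L : LinForm V) {ρ σ} → (∀ v → ρ v ≈M σ v) → ⟦ L ⟧ ρ ≈M ⟦ L ⟧ σ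
⟦⟧-cong []            ρ≈σ k = refl
⟦⟧-cong ((v , c) ∷ L) {ρ} {σ} ρ≈σ k = begin
  coord (⟦ (v , c) ∷ L ⟧ ρ) k              ≡⟨ coord-⟦∷⟧ v c L ρ k ⟩
  c *ℚ coord (ρ v) k +ℚ coord (⟦ L ⟧ ρ) k  ≡⟨ cong₂ (λ x l → c *ℚ x +ℚ l) (ρ≈σ v k) (⟦⟧-cong L ρ≈σ k) ⟩
  c *ℚ coord (σ v) k +ℚ coord (⟦ L ⟧ σ) k  ≡⟨ sym (coord-⟦∷⟧ v c L σ k) ⟩
  coord (⟦ (v , c) ∷ L ⟧ σ) k              ∎
  where open ≡-Reasoning

⟦renameForm⟧ : ∀ (f : V → W) L σ → ⟦ renameForm f L ⟧ σ ≡ ⟦ L ⟧ (σ ∘ f)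
⟦renameForm⟧ f []            σ = refl
⟦renameForm⟧ f ((v , c) ∷ L) σ = cong (scaleM c (σ (f v)) +M_) (⟦renameForm⟧ f L σ)

Vanishes : LinForm V → (V → M) → Set
Vanishes L ρ = ⟦ L ⟧ ρ ≈M []

vanishes? : (L : LinForm V) (ρ : V → M) → Dec (Vanishes L ρ)
vanishes? L ρ = ⟦ L ⟧ ρ ≈M? []

Vanishes-resp : ∀ (L : LinForm V) (L′ : LinForm W) {ρ σ} →
                ⟦ L ⟧ ρ ≈M ⟦ L′ ⟧ σ → Vanishes L ρ ⇔ Vanishes L′ σ
Vanishes-resp L L′ L≈L′ =
  mk⇔ (λ L≈0 k → trans (sym (L≈L′ k)) (L≈0 k)) (λ L′≈0 k → trans (L≈L′ k) (L′≈0 k))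

x-y≡0⇔x≡y : ∀ x y → (x +ℚ -ℚ 1ℚ *ℚ y ≡ 0ℚ) ⇔ (x ≡ y)
x-y≡0⇔x≡y x y = mk⇔ x≡y (λ { refl → solve 1 (λ x → x :+ :- con 1ℚ :* x := con 0ℚ) refl x })
  where
  x≡y : x +ℚ -ℚ 1ℚ *ℚ y ≡ 0ℚ → x ≡ y
  x≡y x-y≡0 = begin
    x                       ≡⟨ solve 2 (λ x y → x := (x :+ :- con 1ℚ :* y) :+ y) refl x y ⟩
    x +ℚ -ℚ 1ℚ *ℚ y +ℚ y    ≡⟨ cong (_+ℚ y) x-y≡0 ⟩
    0ℚ +ℚ y                 ≡⟨ solve 1 (λ y → con 0ℚ :+ y := y) refl y ⟩
    y                       ∎
    where open ≡-Reasoning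

Vanishes-⊖ : ∀ (L L′ : LinForm V) {ρ a b} → ⟦ L ⟧ ρ ≈M a → ⟦ L′ ⟧ ρ ≈M b →
             Vanishes (L ⊖ L′) ρ ⇔ a ≈M b
Vanishes-⊖ L L′ {ρ} {a} {b} L≈a L′≈b = ∀-cong-⇔ λ k →
  ⇔.trans (mk⇔ (trans (sym (value k))) (trans (value k))) (x-y≡0⇔x≡y (coord a k) (coord b k))
  where
  value : ∀ k → coord (⟦ L ⊖ L′ ⟧ ρ) k ≡ coord a k +ℚ -ℚ 1ℚ *ℚ coord b k
  value k = trans (coord-⟦++⟧ L _ ρ k)
    (cong₂ _+ℚ_ (L≈a k) (trans (coord-⟦scale⟧ (-ℚ 1ℚ) L′ ρ k) (cong (-ℚ 1ℚ *ℚ_) (L′≈b k))))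

infixr 6 _∧q_
infixr 5 _∨q_

data QF (V : Set) : Set where
  atom      : LinForm V → QF V
  ¬q_       : QF V → QF V
  _∧q_ _∨q_ : QF V → QF V → QF V

Holds : QF V → (V → M) → Set
Holds (atom L) ρ = Vanishes L ρ
Holds (¬q p)   ρ = ¬ Holds p ρ
Holds (p ∧q q) ρ = Holds p ρ × Holds q ρ
Holds (p ∨q q) ρ = Holds p ρ ⊎ Holds q ρ

holds? : (q : QF V) (ρ : V → M) → Dec (Holds q ρ)
holds? (atom L) ρ = vanishes? L ρ
holds? (¬q p)   ρ = ¬? (holds? p ρ)
holds? (p ∧q q) ρ = holds? p ρ ×-dec holds? q ρ
holds? (p ∨q q) ρ = holds? p ρ ⊎-dec holds? q ρ

⊤q ⊥q : QF V
⊤q = atom []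
⊥q = ¬q ⊤q

atoms : QF V → List (LinForm V)
atoms (atom L) = L ∷ []
atoms (¬q p)   = atoms p
atoms (p ∧q q) = atoms p ++ˡ atoms q
atoms (p ∨q q) = atoms p ++ˡ atoms q

replaceAtoms : (LinForm V → QF W) → QF V → QF W
replaceAtoms f (atom L) = f L
replaceAtoms f (¬q p)   = ¬q replaceAtoms f p
replaceAtoms f (p ∧q q) = replaceAtoms f p ∧q replaceAtoms f q
replaceAtoms f (p ∨q q) = replaceAtoms f p ∨q replaceAtoms f q

Holds-replaceAtoms : ∀ (f : LinForm V → QF W) q {σ ρ} →
                     All (λ L → Holds (f L) σ ⇔ Vanishes L ρ) (atoms q) →
                     Holds (replaceAtoms f q) σ ⇔ Holds q ρ
Holds-replaceAtoms f (atom L) (fL⇔L ∷ []) = fL⇔L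
Holds-replaceAtoms f (¬q p)   same        = ¬-cong-⇔ (Holds-replaceAtoms f p same)
Holds-replaceAtoms f (p ∧q q) same        =
  let samep , sameq = ++⁻ (atoms p) same
  in  Holds-replaceAtoms f p samep ×-⇔ Holds-replaceAtoms f q sameq
Holds-replaceAtoms f (p ∨q q) same        =
  let samep , sameq = ++⁻ (atoms p) same
  in  Holds-replaceAtoms f p samep ⊎-⇔ Holds-replaceAtoms f q sameq

rename : (V → W) → QF V → QF W
rename f = replaceAtoms (atom ∘ renameForm f)

Holds-rename : ∀ (f : V → W) q {σ ρ} → (∀ v → σ (f v) ≈M ρ v) → Holds (rename f q) σ ⇔ Holds q ρ
Holds-rename f q {σ} {ρ} σf≈ρ = Holds-replaceAtoms _ q (All.universal same _)
  where
  same : ∀ L → Vanishes (renameForm f L) σ ⇔ Vanishes L ρ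
  same L = Vanishes-resp (renameForm f L) L λ k →
    trans (cong (λ a → coord a k) (⟦renameForm⟧ f L σ)) (⟦⟧-cong L σf≈ρ k)

⋀ : ∀ {n} → (Fin n → QF V) → QF V
⋀ {n = zero}  p = ⊤q
⋀ {n = suc n} p = p zero ∧q ⋀ (p ∘ suc)

Holds-⋀ : ∀ {n} (p : Fin n → QF V) ρ → Holds (⋀ p) ρ ⇔ (∀ i → Holds (p i) ρ)
Holds-⋀ {n = zero}  p ρ = mk⇔ (λ _ ()) (λ _ _ → refl)
Holds-⋀ {n = suc n} p ρ = mk⇔
  (λ { (p₀ , ps) zero → p₀ ; (p₀ , ps) (suc i) → to (Holds-⋀ (p ∘ suc) ρ) ps i })
  (λ ps → ps zero , from (Holds-⋀ (p ∘ suc) ρ) (ps ∘ suc))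

anyOf : {A : Set} → List A → (A → QF V) → QF V
anyOf []       p = ⊥q
anyOf (x ∷ xs) p = p x ∨q anyOf xs p

Holds-anyOf : ∀ {A : Set} (xs : List A) (p : A → QF V) ρ →
              Holds (anyOf xs p) ρ ⇔ Any (λ x → Holds (p x) ρ) xs
Holds-anyOf []       p ρ = mk⇔ (λ ⊤-fails → contradiction (λ _ → refl) ⊤-fails) (λ ())
Holds-anyOf (x ∷ xs) p ρ = mk⇔
  (λ { (inj₁ px) → here px ; (inj₂ pxs) → there (to (Holds-anyOf xs p ρ) pxs) })
  (λ { (here px) → inj₁ px ; (there pxs) → inj₂ (from (Holds-anyOf xs p ρ) pxs) })

_◂_ : M → (V → M) → Maybe V → M
(y ◂ ρ) nothing  = y
(y ◂ ρ) (just v) = ρ v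

ycoeff : LinForm (Maybe V) → ℚ
ycoeff []                  = 0ℚ
ycoeff ((nothing , c) ∷ L) = c +ℚ ycoeff L
ycoeff ((just _ , _) ∷ L)  = ycoeff L

yfree : LinForm (Maybe V) → LinForm V
yfree []                  = []
yfree ((nothing , _) ∷ L) = yfree L
yfree ((just v , c) ∷ L)  = (v , c) ∷ yfree L

coord-⟦◂⟧ : ∀ (L : LinForm (Maybe V)) y ρ k →
            coord (⟦ L ⟧ (y ◂ ρ)) k ≡ ycoeff L *ℚ coord y k +ℚ coord (⟦ yfree L ⟧ ρ) k
coord-⟦◂⟧ []                  y ρ k = solve 1 (λ y → con 0ℚ := con 0ℚ :* y :+ con 0ℚ) refl (coord y k)
coord-⟦◂⟧ ((nothing , c) ∷ L) y ρ k = begin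
  coord (⟦ (nothing , c) ∷ L ⟧ (y ◂ ρ)) k  ≡⟨ coord-⟦∷⟧ nothing c L (y ◂ ρ) k ⟩
  c *ℚ Y +ℚ coord (⟦ L ⟧ (y ◂ ρ)) k        ≡⟨ cong (c *ℚ Y +ℚ_) (coord-⟦◂⟧ L y ρ k) ⟩
  c *ℚ Y +ℚ (ycoeff L *ℚ Y +ℚ r)           ≡⟨ solve 4 (λ c y a r → c :* y :+ (a :* y :+ r) := (c :+ a) :* y :+ r)
                                                    refl c Y (ycoeff L) r ⟩
  (c +ℚ ycoeff L) *ℚ Y +ℚ r                ∎
  where
  open ≡-Reasoning
  Y = coord y k
  r = coord (⟦ yfree L ⟧ ρ) k
coord-⟦◂⟧ ((just v , c) ∷ L)  y ρ k = begin
  coord (⟦ (just v , c) ∷ L ⟧ (y ◂ ρ)) k   ≡⟨ coord-⟦∷⟧ (just v) c L (y ◂ ρ) k ⟩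
  c *ℚ x +ℚ coord (⟦ L ⟧ (y ◂ ρ)) k        ≡⟨ cong (c *ℚ x +ℚ_) (coord-⟦◂⟧ L y ρ k) ⟩
  c *ℚ x +ℚ (ycoeff L *ℚ Y +ℚ r)           ≡⟨ solve 5 (λ c x a y r → c :* x :+ (a :* y :+ r) := a :* y :+ (c :* x :+ r))
                                                    refl c x (ycoeff L) Y r ⟩
  ycoeff L *ℚ Y +ℚ (c *ℚ x +ℚ r)           ≡⟨ cong (ycoeff L *ℚ Y +ℚ_) (sym (coord-⟦∷⟧ v c (yfree L) ρ k)) ⟩
  ycoeff L *ℚ Y +ℚ coord (⟦ (v , c) ∷ yfree L ⟧ ρ) k ∎
  where
  open ≡-Reasoning
  x = coord (ρ v) k
  Y = coord y k
  r = coord (⟦ yfree L ⟧ ρ) k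

⟦◂⟧-ycoeff≡0 : ∀ (L : LinForm (Maybe V)) y ρ → ycoeff L ≡ 0ℚ → ⟦ L ⟧ (y ◂ ρ) ≈M ⟦ yfree L ⟧ ρ
⟦◂⟧-ycoeff≡0 L y ρ a≡0 k = begin
  coord (⟦ L ⟧ (y ◂ ρ)) k   ≡⟨ coord-⟦◂⟧ L y ρ k ⟩
  ycoeff L *ℚ Y +ℚ r        ≡⟨ cong (λ a → a *ℚ Y +ℚ r) a≡0 ⟩
  0ℚ *ℚ Y +ℚ r              ≡⟨ solve 2 (λ y r → con 0ℚ :* y :+ r := r) refl Y r ⟩
  r                         ∎
  where
  open ≡-Reasoning
  Y = coord y k
  r = coord (⟦ yfree L ⟧ ρ) k

substY : LinForm V → QF (Maybe V) → QF V
substY R = replaceAtoms λ L → atom (yfree L ++ˡ scale (ycoeff L) R)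

Holds-substY : ∀ (q : QF (Maybe V)) {R y ρ} → y ≈M ⟦ R ⟧ ρ → Holds (substY R q) ρ ⇔ Holds q (y ◂ ρ)
Holds-substY q {R} {y} {ρ} y≈R =
  Holds-replaceAtoms _ q (All.universal (λ L → Vanishes-resp (yfree L ++ˡ scale (ycoeff L) R) L (agree L)) _)
  where
  agree : ∀ L k → coord (⟦ yfree L ++ˡ scale (ycoeff L) R ⟧ ρ) k ≡ coord (⟦ L ⟧ (y ◂ ρ)) k
  agree L k = begin
    coord (⟦ yfree L ++ˡ scale (ycoeff L) R ⟧ ρ) k  ≡⟨ coord-⟦++⟧ (yfree L) _ ρ k ⟩
    r +ℚ coord (⟦ scale (ycoeff L) R ⟧ ρ) k         ≡⟨ cong (r +ℚ_) (coord-⟦scale⟧ (ycoeff L) R ρ k) ⟩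
    r +ℚ ycoeff L *ℚ coord (⟦ R ⟧ ρ) k              ≡⟨ cong (λ z → r +ℚ ycoeff L *ℚ z) (sym (y≈R k)) ⟩
    r +ℚ ycoeff L *ℚ coord y k                      ≡⟨ +-comm r _ ⟩
    ycoeff L *ℚ coord y k +ℚ r                      ≡⟨ sym (coord-⟦◂⟧ L y ρ k) ⟩
    coord (⟦ L ⟧ (y ◂ ρ)) k                         ∎
    where
    open ≡-Reasoning
    r = coord (⟦ yfree L ⟧ ρ) k

solve-linear : ∀ a i y r → i *ℚ a ≡ 1ℚ → a *ℚ y +ℚ r ≡ 0ℚ → y ≡ -ℚ i *ℚ r
solve-linear a i y r ia≡1 ay+r≡0 = begin
  y                                ≡⟨ solve 1 (λ y → y := con 1ℚ :* y) refl y ⟩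
  1ℚ *ℚ y                          ≡⟨ cong (_*ℚ y) (sym ia≡1) ⟩
  i *ℚ a *ℚ y                      ≡⟨ solve 4 (λ i a y r → i :* a :* y := i :* (a :* y :+ r) :+ :- i :* r)
                                           refl i a y r ⟩
  i *ℚ (a *ℚ y +ℚ r) +ℚ -ℚ i *ℚ r  ≡⟨ cong (λ z → i *ℚ z +ℚ -ℚ i *ℚ r) ay+r≡0 ⟩
  i *ℚ 0ℚ +ℚ -ℚ i *ℚ r             ≡⟨ solve 2 (λ i r → i :* con 0ℚ :+ :- i :* r := :- i :* r) refl i r ⟩
  -ℚ i *ℚ r                        ∎
  where open ≡-Reasoning

-- The solution y of the atom L = 0; when ycoeff L ≡ 0 the value is a dummy.
testPoint : LinForm (Maybe V) → LinForm V
testPoint L with ycoeff L ≟ℚ 0ℚ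
... | yes _   = []
... | no  a≢0 = scale (-ℚ (1/ ycoeff L) {{≢-nonZero a≢0}}) (yfree L)

vanishes⇒testPoint : ∀ (L : LinForm (Maybe V)) {y ρ} →
                     ycoeff L ≢ 0ℚ → Vanishes L (y ◂ ρ) → y ≈M ⟦ testPoint L ⟧ ρ
vanishes⇒testPoint L {y} {ρ} a≢0 vanishes with ycoeff L ≟ℚ 0ℚ
... | yes a≡0  = contradiction a≡0 a≢0
... | no  a≢0′ = λ k →
  trans (solve-linear (ycoeff L) (1/ ycoeff L) (coord y k) (coord (⟦ yfree L ⟧ ρ) k) (*-inverseˡ (ycoeff L))
                      (trans (sym (coord-⟦◂⟧ L y ρ k)) (vanishes k)))
        (sym (coord-⟦scale⟧ (-ℚ (1/ ycoeff L)) (yfree L) ρ k))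
  where instance _ = ≢-nonZero a≢0′

Generic : (V → M) → M → LinForm (Maybe V) → Set
Generic ρ y L = ycoeff L ≢ 0ℚ → ¬ Vanishes L (y ◂ ρ)

testPoint-or-generic : ∀ (Ls : List (LinForm (Maybe V))) ρ y →
                       Any (λ L → y ≈M ⟦ testPoint L ⟧ ρ) Ls ⊎ All (Generic ρ y) Ls
testPoint-or-generic Ls ρ y with any? (λ L → y ≈M? ⟦ testPoint L ⟧ ρ) Ls
... | yes special  = inj₁ special
... | no  ¬special =
  inj₂ (All.map (λ {L} y≉ a≢0 → y≉ ∘ vanishes⇒testPoint L a≢0) (¬Any⇒All¬ Ls ¬special))

supportBound : List (LinForm (Maybe V)) → (V → M) → ℕ
supportBound []       ρ = 0
supportBound (L ∷ Ls) ρ = length (⟦ yfree L ⟧ ρ) ⊔ supportBound Ls ρ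

≤-supportBound : ∀ (Ls : List (LinForm (Maybe V))) ρ →
                 All (λ L → length (⟦ yfree L ⟧ ρ) ≤ supportBound Ls ρ) Ls
≤-supportBound []       ρ = []
≤-supportBound (L ∷ Ls) ρ = m≤m⊔n _ _ ∷ All.map (λ h → ≤-trans h (m≤n⊔m _ _)) (≤-supportBound Ls ρ)

unit-generic : ∀ (L : LinForm (Maybe V)) ρ {N} → length (⟦ yfree L ⟧ ρ) ≤ N → Generic ρ (unit N) L
unit-generic L ρ {N} short a≢0 vanishes = a≢0 (begin
  ycoeff L                                   ≡⟨ solve 1 (λ a → a := a :* con 1ℚ :+ con 0ℚ) refl (ycoeff L) ⟩
  ycoeff L *ℚ 1ℚ +ℚ 0ℚ                       ≡⟨ cong₂ (λ e r → ycoeff L *ℚ e +ℚ r)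
                                                     (sym (coord-unit N)) (sym (coord-beyond (⟦ yfree L ⟧ ρ) short)) ⟩
  ycoeff L *ℚ coord (unit N) N +ℚ r          ≡⟨ sym (coord-⟦◂⟧ L (unit N) ρ N) ⟩
  coord (⟦ L ⟧ (unit N ◂ ρ)) N               ≡⟨ vanishes N ⟩
  0ℚ                                         ∎)
  where
  open ≡-Reasoning
  r = coord (⟦ yfree L ⟧ ρ) N

farPoint : List (LinForm (Maybe V)) → (V → M) → M
farPoint Ls ρ = unit (supportBound Ls ρ)

farPoint-generic : ∀ (Ls : List (LinForm (Maybe V))) ρ → All (Generic ρ (farPoint Ls ρ)) Ls
farPoint-generic Ls ρ = All.map (λ {L} → unit-generic L ρ) (≤-supportBound Ls ρ)

atomAtInfinity : LinForm (Maybe V) → QF V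
atomAtInfinity L with ycoeff L ≟ℚ 0ℚ
... | yes _ = atom (yfree L)
... | no  _ = ⊥q

atInfinity : QF (Maybe V) → QF V
atInfinity = replaceAtoms atomAtInfinity

Holds-atomAtInfinity : ∀ (L : LinForm (Maybe V)) {ρ y} →
                       Generic ρ y L → Holds (atomAtInfinity L) ρ ⇔ Vanishes L (y ◂ ρ)
Holds-atomAtInfinity L {ρ} {y} generic with ycoeff L ≟ℚ 0ℚ
... | yes a≡0 = Vanishes-resp (yfree L) L λ k → sym (⟦◂⟧-ycoeff≡0 L y ρ a≡0 k)
... | no  a≢0 = mk⇔ (λ ⊤-fails → contradiction (λ _ → refl) ⊤-fails)
                    (λ vanishes → contradiction vanishes (generic a≢0))

Holds-atInfinity : ∀ (q : QF (Maybe V)) {ρ y} →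
                   All (Generic ρ y) (atoms q) → Holds (atInfinity q) ρ ⇔ Holds q (y ◂ ρ)
Holds-atInfinity q generic = Holds-replaceAtoms atomAtInfinity q (All.map (Holds-atomAtInfinity _) generic)

elim : QF (Maybe V) → QF V
elim q = atInfinity q ∨q anyOf (atoms q) (λ L → substY (testPoint L) q)

Holds-elim : ∀ (q : QF (Maybe V)) ρ → Holds (elim q) ρ ⇔ (∃[ y ] Holds q (y ◂ ρ))
Holds-elim q ρ = mk⇔ witness eliminate
  where
  witness : Holds (elim q) ρ → ∃[ y ] Holds q (y ◂ ρ)
  witness (inj₁ holds∞) =
    farPoint (atoms q) ρ , to (Holds-atInfinity q (farPoint-generic (atoms q) ρ)) holds∞
  witness (inj₂ holdsAt) with Any.satisfied (to (Holds-anyOf (atoms q) _ ρ) holdsAt)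
  ... | L , holdsL = ⟦ testPoint L ⟧ ρ , to (Holds-substY q (λ _ → refl)) holdsL
  eliminate : ∃[ y ] Holds q (y ◂ ρ) → Holds (elim q) ρ
  eliminate (y , holds) with testPoint-or-generic (atoms q) ρ y
  ... | inj₁ special = inj₂ (from (Holds-anyOf (atoms q) _ ρ)
                                  (Any.map (λ y≈ → from (Holds-substY q y≈) holds) special))
  ... | inj₂ generic = inj₁ (from (Holds-atInfinity q generic) holds)

linearise : ∀ {n} → Term n → LinForm (Fin n)
linearise (var i) = varForm i
linearise (s ⊕ t) = linearise s ++ˡ linearise t

⟦linearise⟧ : ∀ {n} (t : Term n) (ρ : Vec M n) → ⟦ linearise t ⟧ (lookup ρ) ≈M evalT t ρ
⟦linearise⟧ (var i) ρ   = ⟦varForm⟧ i (lookup ρ)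
⟦linearise⟧ (s ⊕ t) ρ k = begin
  coord (⟦ linearise s ++ˡ linearise t ⟧ (lookup ρ)) k  ≡⟨ coord-⟦++⟧ (linearise s) _ (lookup ρ) k ⟩
  coord (⟦ linearise s ⟧ (lookup ρ)) k +ℚ
  coord (⟦ linearise t ⟧ (lookup ρ)) k                  ≡⟨ cong₂ _+ℚ_ (⟦linearise⟧ s ρ k) (⟦linearise⟧ t ρ k) ⟩
  coord (evalT s ρ) k +ℚ coord (evalT t ρ) k            ≡⟨ sym (coord-+M (evalT s ρ) (evalT t ρ) k) ⟩
  coord (evalT s ρ +M evalT t ρ) k                      ∎
  where open ≡-Reasoning

unsuc : ∀ {n} → Fin (suc n) → Maybe (Fin n)
unsuc zero    = nothing
unsuc (suc i) = just i

toQF : ∀ {n} → Formula n → QF (Fin n)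
toQF (s ≐ t)  = atom (linearise s ⊖ linearise t)
toQF (¬' φ)   = ¬q toQF φ
toQF (φ ∧' ψ) = toQF φ ∧q toQF ψ
toQF (∃' φ)   = elim (rename unsuc (toQF φ))

Sat⇔Holds : ∀ {n} (φ : Formula n) (ρ : Vec M n) → Sat φ ρ ⇔ Holds (toQF φ) (lookup ρ)
Sat⇔Holds (s ≐ t)  ρ = ⇔.sym (Vanishes-⊖ (linearise s) (linearise t) {a = evalT s ρ} {b = evalT t ρ}
                                         (⟦linearise⟧ s ρ) (⟦linearise⟧ t ρ))
Sat⇔Holds (¬' φ)   ρ = ¬-cong-⇔ (Sat⇔Holds φ ρ)
Sat⇔Holds (φ ∧' ψ) ρ = Sat⇔Holds φ ρ ×-⇔ Sat⇔Holds ψ ρ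
Sat⇔Holds (∃' φ)   ρ = ⇔.trans
  (∃-cong-⇔ λ a → ⇔.trans (Sat⇔Holds φ (a ∷ ρ))
                          (⇔.sym (Holds-rename unsuc (toQF φ) λ { zero _ → refl ; (suc _) _ → refl })))
  (⇔.sym (Holds-elim (rename unsuc (toQF φ)) (lookup ρ)))

∃>1-map : ∀ {P Q : M → Set} → (∀ y → P y → Q y) → ∃>1 K P → ∃>1 K Q
∃>1-map f (ys , distinct , holds) = ys , distinct , λ i → f (ys i) (holds i)

∃>-map : ∀ m {P Q : Vec M m → Set} → (∀ ys → P ys → Q ys) → ∃> K m P → ∃> K m Q
∃>-map zero    f = f []
∃>-map (suc m) f = ∃>1-map λ y → ∃>-map m λ ys → f (y ∷ ys)

∃>1-⇔ : ∀ {P Q : M → Set} → (∀ y → P y ⇔ Q y) → ∃>1 K P ⇔ ∃>1 K Q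
∃>1-⇔ P⇔Q = mk⇔ (∃>1-map (to ∘ P⇔Q)) (∃>1-map (from ∘ P⇔Q))

∃>-⇔ : ∀ m {P Q : Vec M m → Set} → (∀ ys → P ys ⇔ Q ys) → ∃> K m P ⇔ ∃> K m Q
∃>-⇔ m P⇔Q = mk⇔ (∃>-map m (to ∘ P⇔Q)) (∃>-map m (from ∘ P⇔Q))

∃>1-≤ : ∀ {K′} {P : M → Set} → K′ ≤ K → ∃>1 K P → ∃>1 K′ P
∃>1-≤ K′≤K (ys , distinct , holds) =
  (λ i → ys (inject≤ i (s≤s K′≤K))) ,
  (λ i j i≢j → distinct _ _ (i≢j ∘ inject≤-injective (s≤s K′≤K) (s≤s K′≤K) i j)) ,
  (λ i → holds _)

∃>-≤ : ∀ {K′} m {P : Vec M m → Set} → K′ ≤ K → ∃> K m P → ∃> K′ m P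
∃>-≤ zero    K′≤K many = many
∃>-≤ {K′ = K′} (suc m) {P} K′≤K many =
  ∃>1-≤ {P = λ y → ∃> K′ m (λ ys → P (y ∷ ys))} K′≤K
        (∃>1-map (λ y → ∃>-≤ m {P = λ ys → P (y ∷ ys)} K′≤K) many)

covered⇒¬∃>1 : ∀ {A : Set} (xs : List A) (f : A → M) {P : M → Set} →
               (∀ y → P y → Any (λ x → y ≈M f x) xs) → ¬ ∃>1 (length xs) P
covered⇒¬∃>1 xs f covered (ys , distinct , holds) =
  let i , j , i<j , same = pigeonhole (n<1+n (length xs)) (Any.index ∘ near)
  in  distinct i j (<⇒≢ i<j) λ k → trans (lookup-index (near i) k)
        (sym (subst (λ t → ys j ≈M f (List.lookup xs t)) (sym same) (lookup-index (near j)) k))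
  where
  near : ∀ i → Any (λ x → ys i ≈M f x) xs
  near i = covered (ys i) (holds i)

Dichotomy₁ : ℕ → (M → Set) → Set
Dichotomy₁ K P = ¬ ∃>1 K P ⊎ ¬ ∃>1 K (λ y → ¬ P y)

Dichotomy : ℕ → (m : ℕ) → (Vec M m → Set) → Set
Dichotomy K m P = ¬ ∃> K m P ⊎ ¬ ∃> K m (λ ys → ¬ P ys)

Dichotomy₁-⇔ : ∀ {P Q : M → Set} → (∀ y → P y ⇔ Q y) → Dichotomy₁ K P → Dichotomy₁ K Q
Dichotomy₁-⇔ P⇔Q (inj₁ few)  = inj₁ (few ∘ from (∃>1-⇔ P⇔Q))
Dichotomy₁-⇔ P⇔Q (inj₂ few¬) = inj₂ (few¬ ∘ from (∃>1-⇔ (¬-cong-⇔ ∘ P⇔Q)))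

Dichotomy-⇔ : ∀ m {P Q : Vec M m → Set} → (∀ ys → P ys ⇔ Q ys) → Dichotomy K m P → Dichotomy K m Q
Dichotomy-⇔ m P⇔Q (inj₁ few)  = inj₁ (few ∘ from (∃>-⇔ m P⇔Q))
Dichotomy-⇔ m P⇔Q (inj₂ few¬) = inj₂ (few¬ ∘ from (∃>-⇔ m (¬-cong-⇔ ∘ P⇔Q)))

dichotomy-zero : ∀ (P : Vec M 0 → Set) → Dec (P []) → Dichotomy K 0 P
dichotomy-zero P (yes p)  = inj₂ λ ¬p → ¬p p
dichotomy-zero P (no  ¬p) = inj₁ ¬p

dichotomy-cons : ∀ {K₁ K₂} m (P : Vec M (suc m) → Set) →
                 (∀ y → Dichotomy K₁ m (λ ys → P (y ∷ ys))) →
                 Dichotomy₁ K₂ (λ y → ∃> K₁ m (λ ys → P (y ∷ ys))) →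
                 Dichotomy (K₁ ⊔ K₂) (suc m) P
dichotomy-cons {K₁} {K₂} m P fibre (inj₁ few) = inj₁ λ many →
  few (∃>1-≤ {P = λ y → ∃> K₁ m (λ ys → P (y ∷ ys))} (m≤n⊔m K₁ K₂)
             (∃>1-map (λ y → ∃>-≤ m {P = λ ys → P (y ∷ ys)} (m≤m⊔n K₁ K₂)) many))
dichotomy-cons {K₁} {K₂} m P fibre (inj₂ few¬) = inj₂ λ many¬ →
  few¬ (∃>1-≤ {P = λ y → ¬ ∃> K₁ m (λ ys → P (y ∷ ys))} (m≤n⊔m K₁ K₂)
              (∃>1-map few-in-fibre many¬))
  where
  few-in-fibre : ∀ y → ∃> (K₁ ⊔ K₂) m (λ ys → ¬ P (y ∷ ys)) → ¬ ∃> K₁ m (λ ys → P (y ∷ ys))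
  few-in-fibre y many¬ with fibre y
  ... | inj₁ few   = few
  ... | inj₂ few¬′ = contradiction (∃>-≤ m (m≤m⊔n K₁ K₂) many¬) few¬′

_▸_ : ∀ {k} → (V → M) → (Fin k → M) → V ⊎ Fin k → M
ρ ▸ zs = [ ρ , zs ]′

shift : ∀ {k} → V ⊎ Fin (suc k) → Maybe V ⊎ Fin k
shift (inj₁ v)       = inj₁ (just v)
shift (inj₂ zero)    = inj₁ nothing
shift (inj₂ (suc i)) = inj₂ i

Holds-shift : ∀ {k} (q : QF (V ⊎ Fin (suc k))) ρ (zs : Fin (suc k) → M) →
              Holds (rename shift q) ((zs zero ◂ ρ) ▸ (zs ∘ suc)) ⇔ Holds q (ρ ▸ zs)
Holds-shift q ρ zs =
  Holds-rename shift q λ { (inj₁ _) _ → refl ; (inj₂ zero) _ → refl ; (inj₂ (suc _)) _ → refl }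

noTuple : V ⊎ Fin 0 → V
noTuple (inj₁ v) = v

Holds-noTuple : ∀ (q : QF (V ⊎ Fin 0)) ρ zs → Holds (rename noTuple q) ρ ⇔ Holds q (ρ ▸ zs)
Holds-noTuple q ρ zs = Holds-rename noTuple q λ { (inj₁ _) _ → refl }

∃-block : (j : ℕ) → QF (V ⊎ Fin j) → QF V
∃-block zero    q = rename noTuple q
∃-block (suc j) q = elim (∃-block j (rename shift q))

Holds-∃-block : ∀ j (q : QF (V ⊎ Fin j)) ρ → Holds (∃-block j q) ρ ⇔ (∃[ zs ] Holds q (ρ ▸ zs))
Holds-∃-block zero    q ρ = mk⇔ (λ holds → (λ ()) , to (Holds-noTuple q ρ λ ()) holds)
                                (λ (zs , holds) → from (Holds-noTuple q ρ zs) holds)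
Holds-∃-block (suc j) q ρ =
  ⇔.trans (Holds-elim _ ρ) (⇔.trans (∃-cong-⇔ λ y → Holds-∃-block j (rename shift q) (y ◂ ρ)) (mk⇔
    (λ (y , zs , holds) → y ∷ᶠ zs , to (Holds-shift q ρ (y ∷ᶠ zs)) holds)
    (λ (zs , holds) → zs zero , zs ∘ suc , from (Holds-shift q ρ zs) holds)))

apart : ∀ {n} → Fin n → Fin n → QF (V ⊎ Fin n)
apart i j with i ≟ᶠ j
... | yes _ = ⊤q
... | no  _ = ¬q atom (varForm (inj₂ i) ⊖ varForm (inj₂ j))

Holds-apart : ∀ {n} (i j : Fin n) ρ (zs : Fin n → M) →
              Holds (apart {V = V} i j) (ρ ▸ zs) ⇔ (i ≢ j → ¬ zs i ≈M zs j)
Holds-apart i j ρ zs with i ≟ᶠ j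
... | yes i≡j = mk⇔ (λ _ i≢j → contradiction i≡j i≢j) (λ _ _ → refl)
... | no  i≢j = ⇔.trans
  (¬-cong-⇔ (Vanishes-⊖ (varForm (inj₂ i)) (varForm (inj₂ j)) {ρ = ρ ▸ zs} {a = zs i} {b = zs j}
                        (⟦varForm⟧ (inj₂ i) (ρ ▸ zs)) (⟦varForm⟧ (inj₂ j) (ρ ▸ zs))))
  (mk⇔ (λ ¬≈ _ → ¬≈) (λ ¬≈ → ¬≈ i≢j))

pick : ∀ {n} → Fin n → Maybe V → V ⊎ Fin n
pick i nothing  = inj₂ i
pick i (just v) = inj₁ v

∃>1-QF : ℕ → QF (Maybe V) → QF V
∃>1-QF K q = ∃-block (suc K) ((⋀ λ i → ⋀ λ j → apart i j) ∧q (⋀ λ i → rename (pick i) q))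

Holds-∃>1-QF : ∀ K (q : QF (Maybe V)) ρ → Holds (∃>1-QF K q) ρ ⇔ ∃>1 K (λ y → Holds q (y ◂ ρ))
Holds-∃>1-QF K q ρ = ⇔.trans (Holds-∃-block (suc K) _ ρ) (∃-cong-⇔ λ zs →
  ⇔.trans (Holds-⋀ _ _) (∀-cong-⇔ λ i → ⇔.trans (Holds-⋀ _ _) (∀-cong-⇔ λ j → Holds-apart i j ρ zs))
  ×-⇔
  ⇔.trans (Holds-⋀ _ _) (∀-cong-⇔ λ i → Holds-rename (pick i) q λ { nothing _ → refl ; (just _) _ → refl }))

∃>-QF : ℕ → (k : ℕ) → QF (V ⊎ Fin k) → QF V
∃>-QF K zero    q = rename noTuple q
∃>-QF K (suc k) q = ∃>1-QF K (∃>-QF K k (rename shift q))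

Holds-∃>-QF : ∀ K k (q : QF (V ⊎ Fin k)) ρ →
              Holds (∃>-QF K k q) ρ ⇔ ∃> K k (λ ys → Holds q (ρ ▸ lookup ys))
Holds-∃>-QF K zero    q ρ = Holds-noTuple q ρ (lookup [])
Holds-∃>-QF K (suc k) q ρ = ⇔.trans (Holds-∃>1-QF K _ ρ) (∃>1-⇔ λ y →
  ⇔.trans (Holds-∃>-QF K k (rename shift q) (y ◂ ρ)) (∃>-⇔ k λ ys → Holds-shift q ρ (lookup (y ∷ ys))))

dichotomy₁-QF : (q : QF (Maybe V)) → ∃[ K ] ∀ ρ → Dichotomy₁ K (λ y → Holds q (y ◂ ρ))
dichotomy₁-QF q = length (atoms q) , λ ρ → dichotomy₁ ρ (holds? (atInfinity q) ρ)
  where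
  testPoints-cover : ∀ ρ (P : M → Set) → (∀ y → All (Generic ρ y) (atoms q) → ¬ P y) →
                     ¬ ∃>1 (length (atoms q)) P
  testPoints-cover ρ P excluded = covered⇒¬∃>1 (atoms q) (λ L → ⟦ testPoint L ⟧ ρ) λ y p →
    [ id , (λ generic → contradiction p (excluded y generic)) ]′ (testPoint-or-generic (atoms q) ρ y)
  dichotomy₁ : ∀ ρ → Dec (Holds (atInfinity q) ρ) → Dichotomy₁ (length (atoms q)) (λ y → Holds q (y ◂ ρ))
  dichotomy₁ ρ (yes holds∞)  = inj₂ (testPoints-cover ρ (λ y → ¬ Holds q (y ◂ ρ)) λ y generic ¬holds →
                                       ¬holds (to (Holds-atInfinity q generic) holds∞))
  dichotomy₁ ρ (no  ¬holds∞) = inj₁ (testPoints-cover ρ (λ y → Holds q (y ◂ ρ)) λ y generic holds →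
                                       ¬holds∞ (from (Holds-atInfinity q generic) holds))

dichotomy-QF : ∀ m (q : QF (V ⊎ Fin m)) → ∃[ K ] ∀ ρ → Dichotomy K m (λ ys → Holds q (ρ ▸ lookup ys))
dichotomy-QF zero    q = 0 , λ ρ →
  dichotomy-zero {K = 0} (λ ys → Holds q (ρ ▸ lookup ys)) (holds? q (ρ ▸ lookup []))
dichotomy-QF (suc m) q = K₁ ⊔ K₂ , λ ρ →
  let fibre⇔ : ∀ y ys → Holds (rename shift q) ((y ◂ ρ) ▸ lookup ys) ⇔ Holds q (ρ ▸ lookup (y ∷ ys))
      fibre⇔ y ys = Holds-shift q ρ (lookup (y ∷ ys))
  in  dichotomy-cons m (λ ys → Holds q (ρ ▸ lookup ys))
        (λ y → Dichotomy-⇔ m (fibre⇔ y) (fibres (y ◂ ρ)))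
        (Dichotomy₁-⇔ (λ y → ⇔.trans (Holds-∃>-QF K₁ m (rename shift q) (y ◂ ρ)) (∃>-⇔ m (fibre⇔ y)))
          (counts ρ))
  where
  K₁     = proj₁ (dichotomy-QF m (rename shift q))
  fibres = proj₂ (dichotomy-QF m (rename shift q))
  K₂     = proj₁ (dichotomy₁-QF (∃>-QF K₁ m (rename shift q)))
  counts = proj₂ (dichotomy₁-QF (∃>-QF K₁ m (rename shift q)))

mainTheorem14 : (n m : ℕ) (φ : Formula (n + suc m)) →
    ∃[ K ] ((xs : Vec M n) →
    (¬ ∃> K (suc m) (λ ys → Sat φ (xs ++ ys)))
    ⊎ (¬ ∃> K (suc m) (λ ys → ¬ Sat φ (xs ++ ys))))
mainTheorem14 n m φ = bound , λ xs → Dichotomy-⇔ (suc m) (holds⇔sat xs) (dichotomy (lookup xs))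
  where
  q = rename (splitAt n) (toQF φ)
  bound     = proj₁ (dichotomy-QF (suc m) q)
  dichotomy = proj₂ (dichotomy-QF (suc m) q)
  holds⇔sat : ∀ xs ys → Holds q (lookup xs ▸ lookup ys) ⇔ Sat φ (xs ++ ys)
  holds⇔sat xs ys = ⇔.trans
    (Holds-rename (splitAt n) (toQF φ) λ i k → cong (λ a → coord a k) (sym (lookup-splitAt n xs ys i)))
    (⇔.sym (Sat⇔Holds φ (xs ++ ys)))
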